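{- Let $m\ge 2$ be an integer and define $T_m(n)=\sum_{k=0}^{n}\left[\binom{2^m k}{n+k}\binom{n}{k}\bmod 2\right]$ for $n\ge0$. Then for every $n\ge 0$, $T_m(n)=1$ if every maximal run of $1$'s in the binary representation of $n$ has length divisible by $m$, and $T_m(n)=0$ otherwise.
   Context: For integers $a$ and $b\ge0$, $\binom{a}{b}=0$ whenever $a<b$. $[x \bmod 2]$ denotes the residue in $\{0,1\}$. For $n=0$ the binary representation is empty and has no runs, so the condition holds vacuously. -}

module Defs where

open import Data.Nat using (ℕ; zero; suc; _+_; _*_; _^_; _%_; _/_)
open import Data.Nat.Combinatorics using (_C_)
open import Data.Bool using (Bool; true; false)
open import Data.List using (List; []; _∷_; upTo; map)
open import Data.Nat.ListAction using (sum)
open import Data.List.Relation.Unary.All using (All)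

-- Binary digits of n, least significant first; binary 0 = [] (empty representation).
-- Defined by well-founded recursion via a fuel argument (fuel n suffices).
binaryAux : ℕ → ℕ → List Bool
binaryAux zero    n = []
binaryAux (suc f) zero = []
binaryAux (suc f) (suc n) = (suc n % 2 Data.Nat.≡ᵇ 1) ∷ binaryAux f (suc n / 2)

binary : ℕ → List Bool
binary n = binaryAux n n

-- Lengths of the maximal runs of 'true' in a list of bits (the current run length
-- is accumulated in the first argument).
runsAux : ℕ → List Bool → List ℕ
runsAux zero    []           = []
runsAux (suc r) []           = suc r ∷ []
runsAux r       (true  ∷ bs) = runsAux (suc r) bs
runsAux zero    (false ∷ bs) = runsAux zero bs
runsAux (suc r) (false ∷ bs) = suc r ∷ runsAux zero bs

onesRuns : ℕ → List ℕ
onesRuns n = runsAux 0 (binary n)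

T : ℕ → ℕ → ℕ
T m n = sum (map (λ k → ((((2 ^ m) * k) C (n + k)) * (n C k)) % 2) (upTo (suc n)))

{-# OPTIONS --safe #-}
-- Reduce both binomials modulo 2 digit by digit (Lucas' theorem for p = 2).
-- Generalise the summand to C(2^m k + e, n + k + c) C(n, k) with a carry c and an
-- offset e. Splitting off the lowest binary digits of n and k expresses the sum for
-- n through the sums for ⌊n/2⌋, and only the states (c, e) = (0, 0), (1, 0) and
-- (1, 2^j) with j < m ever occur. This is a finite automaton reading the digits of
-- n from the least significant one: (0, 0) means "not inside a run of 1's", (1, 0)
-- is a dead state, and (1, 2^j) means "inside a run of 1's that needs j more 1's to
-- reach a length divisible by m".
module Submission where

open import Defs
open import Data.Nat using (ℕ; _≤_)
open import Data.Nat.Divisibility using (_∣_)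
open import Data.List.Relation.Unary.All using (All)
open import Relation.Nullary using (¬_)
open import Relation.Binary.PropositionalEquality using (_≡_)
open import Data.Product using (_×_)

open import Data.Bool using (Bool; true; false)
open import Data.Empty using (⊥-elim)
open import Data.List using (List; []; _∷_; map; upTo; applyUpTo)
open import Data.List.Properties using (map-upTo)
open import Data.List.Relation.Unary.All using ([]; _∷_; head; tail)
open import Data.Nat
  using (zero; suc; _+_; _*_; _^_; _%_; _/_; _<_; _≡ᵇ_; z≤n; s≤s)
open import Data.Nat using (_≤′_; ≤′-refl; ≤′-step)
open import Data.Nat.Combinatorics using (_C_; nCk+nC[k+1]≡[n+1]C[k+1]; k>n⇒nCk≡0)
open import Data.Nat.DivMod
open import Data.Nat.Divisibility using (∣-refl; ∣m∣n⇒∣m+n; ∣m+n∣m⇒∣n; ∣⇒≤)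
open import Data.Nat.Induction using (<-rec)
open import Data.Nat.ListAction using (sum)
open import Data.Nat.Properties
open import Data.Nat.Tactic.RingSolver using (solve-∀)
open import Data.Product using (_,_; proj₁)
open import Function using (_∘_)
open import Function.Bundles using (_⇔_; mk⇔; Equivalence)
open import Relation.Binary.PropositionalEquality
  using (refl; sym; trans; cong; cong₂; subst; module ≡-Reasoning)

open ≡-Reasoning

double : ℕ → ℕ
double zero    = zero
double (suc n) = suc (suc (double n))

double≡2* : ∀ n → double n ≡ 2 * n
double≡2* zero    = refl
double≡2* (suc n) = trans (cong (suc ∘ suc) (double≡2* n)) (sym (*-suc 2 n))

n≤double : ∀ n → n ≤ double n
n≤double zero    = z≤n
n≤double (suc n) = s≤s (≤-trans (n≤double n) (n≤1+n _))

data Bit : ℕ → Set where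
  b0 : Bit 0
  b1 : Bit 1

%2-bit : ∀ x → Bit (x % 2)
%2-bit x with x % 2 | m%n<n x 2
... | 0           | _            = b0
... | 1           | _            = b1
... | suc (suc _) | s≤s (s≤s ())

bit-%2 : ∀ {x} → Bit x → x % 2 ≡ x
bit-%2 b0 = refl
bit-%2 b1 = refl

bit-* : ∀ {x y} → Bit x → Bit y → Bit (x * y)
bit-* b0 _  = b0
bit-* b1 b0 = b0
bit-* b1 b1 = b1

%2-distrib-* : ∀ x y → (x * y) % 2 ≡ (x % 2) * (y % 2)
%2-distrib-* x y = trans (%-distribˡ-* x y 2) (bit-%2 (bit-* (%2-bit x) (%2-bit y)))

[b+double]%2≡b : ∀ {b} → Bit b → ∀ n → (b + double n) % 2 ≡ b
[b+double]%2≡b b0 zero    = refl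
[b+double]%2≡b b1 zero    = refl
[b+double]%2≡b b0 (suc n) = [b+double]%2≡b b0 n
[b+double]%2≡b b1 (suc n) = [b+double]%2≡b b1 n

[2+x]/2≡1+x/2 : ∀ x → suc (suc x) / 2 ≡ suc (x / 2)
[2+x]/2≡1+x/2 x = m/n≡1+[m∸n]/n {suc (suc x)} (s≤s (s≤s z≤n))

[b+double]/2≡n : ∀ {b} → Bit b → ∀ n → (b + double n) / 2 ≡ n
[b+double]/2≡n b0 zero    = refl
[b+double]/2≡n b1 zero    = refl
[b+double]/2≡n b0 (suc n) =
  trans ([2+x]/2≡1+x/2 (double n)) (cong suc ([b+double]/2≡n b0 n))
[b+double]/2≡n b1 (suc n) =
  trans ([2+x]/2≡1+x/2 (suc (double n))) (cong suc ([b+double]/2≡n b1 n))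

data BinaryView : ℕ → Set where
  zero : BinaryView 0
  odd  : ∀ n → BinaryView (suc (double n))
  even : ∀ n → BinaryView (double (suc n))

binaryView : ∀ n → BinaryView n
binaryView zero = zero
binaryView (suc n) with binaryView n
... | zero   = odd 0
... | odd k  = even k
... | even k = odd (suc k)

binary-ind : (P : ℕ → Set) → P 0 →
  (∀ n → P n → P (suc (double n))) → (∀ n → P (suc n) → P (double (suc n))) →
  ∀ n → P n
binary-ind P P0 P-odd P-even = <-rec P step
  where
  step : ∀ n → (∀ {k} → k < n → P k) → P n
  step n rec with binaryView n
  ... | zero   = P0
  ... | odd k  = P-odd k (rec (s≤s (n≤double k)))
  ... | even k = P-even k (rec (s≤s (s≤s (n≤double k))))

binaryAux-fuel : ∀ {f g n} → n ≤ f → n ≤ g → binaryAux f n ≡ binaryAux g n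
binaryAux-fuel {zero}  {zero}  {zero}  _         _         = refl
binaryAux-fuel {zero}  {suc g} {zero}  _         _         = refl
binaryAux-fuel {suc f} {zero}  {zero}  _         _         = refl
binaryAux-fuel {suc f} {suc g} {zero}  _         _         = refl
binaryAux-fuel {suc f} {suc g} {suc n} (s≤s n≤f) (s≤s n≤g) =
  cong (_ ∷_) (binaryAux-fuel (≤-trans half≤n n≤f) (≤-trans half≤n n≤g))
  where
  half≤n : suc n / 2 ≤ n
  half≤n = ≤-pred (m/n<m (suc n) 2 (s≤s (s≤s z≤n)))

binary-odd : ∀ n → binary (suc (double n)) ≡ true ∷ binary n
binary-odd n = cong₂ _∷_
  (cong (_≡ᵇ 1) ([b+double]%2≡b b1 n))
  (trans (cong (binaryAux (double n)) ([b+double]/2≡n b1 n))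
         (binaryAux-fuel (n≤double n) ≤-refl))

binary-even : ∀ n → binary (double (suc n)) ≡ false ∷ binary (suc n)
binary-even n = cong₂ _∷_
  (cong (_≡ᵇ 1) ([b+double]%2≡b b0 (suc n)))
  (trans (cong (binaryAux (suc (double n))) ([b+double]/2≡n b0 (suc n)))
         (binaryAux-fuel (s≤s (n≤double n)) ≤-refl))

sumBelow : (ℕ → ℕ) → ℕ → ℕ
sumBelow f zero    = 0
sumBelow f (suc n) = f 0 + sumBelow (f ∘ suc) n

sumBelow-cong : ∀ {f g} n → (∀ k → f k ≡ g k) → sumBelow f n ≡ sumBelow g n
sumBelow-cong zero    f≗g = refl
sumBelow-cong (suc n) f≗g = cong₂ _+_ (f≗g 0) (sumBelow-cong n (f≗g ∘ suc))

sumBelow-suc : ∀ f n → sumBelow f (suc n) ≡ sumBelow f n + f n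
sumBelow-suc f zero    = +-comm (f 0) 0
sumBelow-suc f (suc n) =
  trans (cong (f 0 +_) (sumBelow-suc (f ∘ suc) n)) (sym (+-assoc (f 0) _ _))

sumBelow-extend : ∀ {f n N} → (∀ {k} → n ≤ k → f k ≡ 0) → n ≤ N →
  sumBelow f N ≡ sumBelow f n
sumBelow-extend {f} {n} vanish n≤N = go (≤⇒≤′ n≤N)
  where
  go : ∀ {N} → n ≤′ N → sumBelow f N ≡ sumBelow f n
  go ≤′-refl                = refl
  go {suc N} (≤′-step n≤′N) = begin
    sumBelow f (suc N)  ≡⟨ sumBelow-suc f N ⟩
    sumBelow f N + f N  ≡⟨ cong (sumBelow f N +_) (vanish (≤′⇒≤ n≤′N)) ⟩
    sumBelow f N + 0    ≡⟨ +-identityʳ _ ⟩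
    sumBelow f N        ≡⟨ go n≤′N ⟩
    sumBelow f n        ∎

sumBelow-double : ∀ f n →
  sumBelow f (double n) ≡ sumBelow (f ∘ double) n + sumBelow (f ∘ suc ∘ double) n
sumBelow-double f zero    = refl
sumBelow-double f (suc n) = begin
  f 0 + (f 1 + sumBelow (f ∘ suc ∘ suc) (double n))
    ≡⟨ cong (λ s → f 0 + (f 1 + s)) (sumBelow-double (f ∘ suc ∘ suc) n) ⟩
  f 0 + (f 1 + (sumBelow (f ∘ double ∘ suc) n + sumBelow (f ∘ suc ∘ double ∘ suc) n))
    ≡⟨ interchange (f 0) _ (f 1) _ ⟩
  (f 0 + sumBelow (f ∘ double ∘ suc) n) + (f 1 + sumBelow (f ∘ suc ∘ double ∘ suc) n)
    ∎
  where
  interchange : ∀ a b c d → a + (c + (b + d)) ≡ (a + b) + (c + d)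
  interchange = solve-∀

sumBelow-*ʳ : ∀ f c n → sumBelow (λ k → f k * c) n ≡ sumBelow f n * c
sumBelow-*ʳ f c zero    = refl
sumBelow-*ʳ f c (suc n) =
  trans (cong (f 0 * c +_) (sumBelow-*ʳ (f ∘ suc) c n)) (sym (*-distribʳ-+ c (f 0) _))

sum-applyUpTo : ∀ f n → sum (applyUpTo f n) ≡ sumBelow f n
sum-applyUpTo f zero    = refl
sum-applyUpTo f (suc n) = cong (f 0 +_) (sum-applyUpTo (f ∘ suc) n)

infix 8 _C₂_

_C₂_ : ℕ → ℕ → ℕ
n C₂ k = (n C k) % 2

C₂-pascal : ∀ n k → suc n C₂ suc k ≡ (n C₂ k + n C₂ suc k) % 2
C₂-pascal n k =
  trans (cong (_% 2) (sym (nCk+nC[k+1]≡[n+1]C[k+1] n k))) (%-distribˡ-+ (n C k) _ 2)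

C₂-%2 : ∀ n k → n C₂ k % 2 ≡ n C₂ k
C₂-%2 n k = m%n%n≡m%n (n C k) 2

[x+x]%2≡0 : ∀ x → (x + x) % 2 ≡ 0
[x+x]%2≡0 x = trans (cong (_% 2) (x+x≡x*2 x)) (m*n%n≡0 x 2)
  where
  x+x≡x*2 : ∀ x → x + x ≡ x * 2
  x+x≡x*2 = solve-∀

mutual
  C₂-even-even : ∀ a b → double a C₂ double b ≡ a C₂ b
  C₂-even-even a       zero    = refl
  C₂-even-even zero    (suc b) = refl
  C₂-even-even (suc a) (suc b) = begin
    suc (suc (double a)) C₂ suc (suc (double b))
      ≡⟨ C₂-pascal (suc (double a)) (suc (double b)) ⟩
    (suc (double a) C₂ suc (double b) + suc (double a) C₂ double (suc b)) % 2
      ≡⟨ cong₂ (λ u v → (u + v) % 2) (C₂-odd-odd a b) (C₂-odd-even a (suc b)) ⟩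
    (a C₂ b + a C₂ suc b) % 2
      ≡⟨ C₂-pascal a b ⟨
    suc a C₂ suc b
      ∎

  C₂-even-odd : ∀ a b → double a C₂ suc (double b) ≡ 0
  C₂-even-odd zero    b = refl
  C₂-even-odd (suc a) b = begin
    suc (suc (double a)) C₂ suc (double b)
      ≡⟨ C₂-pascal (suc (double a)) (double b) ⟩
    (suc (double a) C₂ double b + suc (double a) C₂ suc (double b)) % 2
      ≡⟨ cong₂ (λ u v → (u + v) % 2) (C₂-odd-even a b) (C₂-odd-odd a b) ⟩
    (a C₂ b + a C₂ b) % 2
      ≡⟨ [x+x]%2≡0 (a C₂ b) ⟩
    0
      ∎

  C₂-odd-even : ∀ a b → suc (double a) C₂ double b ≡ a C₂ b
  C₂-odd-even a zero    = refl
  C₂-odd-even a (suc b) = begin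
    suc (double a) C₂ suc (suc (double b))
      ≡⟨ C₂-pascal (double a) (suc (double b)) ⟩
    (double a C₂ suc (double b) + double a C₂ double (suc b)) % 2
      ≡⟨ cong₂ (λ u v → (u + v) % 2) (C₂-even-odd a b) (C₂-even-even a (suc b)) ⟩
    a C₂ suc b % 2
      ≡⟨ C₂-%2 a (suc b) ⟩
    a C₂ suc b
      ∎

  C₂-odd-odd : ∀ a b → suc (double a) C₂ suc (double b) ≡ a C₂ b
  C₂-odd-odd a b = begin
    suc (double a) C₂ suc (double b)
      ≡⟨ C₂-pascal (double a) (double b) ⟩
    (double a C₂ double b + double a C₂ suc (double b)) % 2
      ≡⟨ cong₂ (λ u v → (u + v) % 2) (C₂-even-even a b) (C₂-even-odd a b) ⟩
    (a C₂ b + 0) % 2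
      ≡⟨ cong (_% 2) (+-identityʳ (a C₂ b)) ⟩
    a C₂ b % 2
      ≡⟨ C₂-%2 a b ⟩
    a C₂ b
      ∎

C₂-lucas : ∀ {x y} → Bit x → Bit y → ∀ a b →
  (x + double a) C₂ (y + double b) ≡ x C₂ y * a C₂ b
C₂-lucas b0 b0 a b = trans (C₂-even-even a b) (sym (+-identityʳ (a C₂ b)))
C₂-lucas b0 b1 a b = C₂-even-odd a b
C₂-lucas b1 b0 a b = trans (C₂-odd-even a b) (sym (+-identityʳ (a C₂ b)))
C₂-lucas b1 b1 a b = trans (C₂-odd-odd a b) (sym (+-identityʳ (a C₂ b)))

T′-summand : ℕ → ℕ → ℕ → ℕ → ℕ → ℕ
T′-summand m c e n k = (e + 2 ^ m * k) C₂ (c + (n + k)) * n C₂ k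

T′ : ℕ → ℕ → ℕ → ℕ → ℕ
T′ m c e n = sumBelow (T′-summand m c e n) (suc n)

T≡T′ : ∀ m n → T m n ≡ T′ m 0 0 n
T≡T′ m n = begin
  sum (map g (upTo (suc n)))  ≡⟨ cong sum (map-upTo g (suc n)) ⟩
  sum (applyUpTo g (suc n))   ≡⟨ sum-applyUpTo g (suc n) ⟩
  sumBelow g (suc n)          ≡⟨ sumBelow-cong (suc n) (λ k → %2-distrib-* (top k) (n C k)) ⟩
  T′ m 0 0 n                  ∎
  where
  top g : ℕ → ℕ
  top k = 2 ^ m * k C (n + k)
  g k = (top k * (n C k)) % 2

T′-summand-vanishes : ∀ m c e {n k} → n < k → T′-summand m c e n k ≡ 0
T′-summand-vanishes m c e {n} {k} n<k =
  trans (cong (λ x → (e + 2 ^ m * k) C₂ (c + (n + k)) * (x % 2)) (k>n⇒nCk≡0 n<k))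
        (*-zeroʳ ((e + 2 ^ m * k) C₂ (c + (n + k))))

e+P*0≡e : ∀ e P → e + P * 0 ≡ e
e+P*0≡e e P = trans (cong (e +_) (*-zeroʳ P)) (+-identityʳ e)

T′-zero : ∀ m c e → T′ m c e 0 ≡ e C₂ c
T′-zero m c e = begin
  (e + 2 ^ m * 0) C₂ (c + 0) * 1 + 0  ≡⟨ +-identityʳ _ ⟩
  (e + 2 ^ m * 0) C₂ (c + 0) * 1      ≡⟨ *-identityʳ _ ⟩
  (e + 2 ^ m * 0) C₂ (c + 0)          ≡⟨ cong₂ _C₂_ (e+P*0≡e e (2 ^ m)) (+-identityʳ c) ⟩
  e C₂ c                              ∎

top-digit : ∀ e₀ e k₀ k P →
  e₀ + double e + 2 * P * (k₀ + double k) ≡ e₀ + double (e + P * k₀ + 2 * P * k)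
top-digit e₀ e k₀ k P
  rewrite double≡2* e | double≡2* k | double≡2* (e + P * k₀ + 2 * P * k) = ring e₀ e k₀ k P
  where
  ring : ∀ e₀ e k₀ k P →
    e₀ + 2 * e + 2 * P * (k₀ + 2 * k) ≡ e₀ + 2 * (e + P * k₀ + 2 * P * k)
  ring = solve-∀

bottom-digit : ∀ c n₀ k₀ n k →
  c + (n₀ + double n + (k₀ + double k))
    ≡ (c + n₀ + k₀) % 2 + double ((c + n₀ + k₀) / 2 + (n + k))
bottom-digit c n₀ k₀ n k
  rewrite double≡2* n | double≡2* k | double≡2* ((c + n₀ + k₀) / 2 + (n + k)) = begin
    c + (n₀ + 2 * n + (k₀ + 2 * k))  ≡⟨ regroup c n₀ k₀ n k ⟩
    s + 2 * (n + k)                   ≡⟨ cong (_+ 2 * (n + k)) (m≡m%n+[m/n]*n s 2) ⟩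
    s % 2 + s / 2 * 2 + 2 * (n + k)   ≡⟨ carry (s % 2) (s / 2) (n + k) ⟩
    s % 2 + 2 * (s / 2 + (n + k))     ∎
  where
  s : ℕ
  s = c + n₀ + k₀
  regroup : ∀ c n₀ k₀ n k → c + (n₀ + 2 * n + (k₀ + 2 * k)) ≡ c + n₀ + k₀ + 2 * (n + k)
  regroup = solve-∀
  carry : ∀ r q t → r + q * 2 + 2 * t ≡ r + 2 * (q + t)
  carry = solve-∀

lowDigitFactor : ℕ → ℕ → ℕ → ℕ → ℕ
lowDigitFactor c e₀ n₀ k₀ = e₀ C₂ ((c + n₀ + k₀) % 2) * n₀ C₂ k₀

T′-summand-digit : ∀ m c {e₀ n₀ k₀} → Bit e₀ → Bit n₀ → Bit k₀ → ∀ e n k →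
  T′-summand (suc m) c (e₀ + double e) (n₀ + double n) (k₀ + double k)
    ≡ T′-summand (suc m) ((c + n₀ + k₀) / 2) (e + 2 ^ m * k₀) n k
      * lowDigitFactor c e₀ n₀ k₀
T′-summand-digit m c {e₀} {n₀} {k₀} e₀b n₀b k₀b e n k = begin
  (e₀ + double e + 2 ^ suc m * (k₀ + double k)) C₂ (c + (n₀ + double n + (k₀ + double k)))
    * (n₀ + double n) C₂ (k₀ + double k)
    ≡⟨ cong₂ (λ t b → t C₂ b * (n₀ + double n) C₂ (k₀ + double k))
             (top-digit e₀ e k₀ k (2 ^ m)) (bottom-digit c n₀ k₀ n k) ⟩
  (e₀ + double e′) C₂ (s % 2 + double (s / 2 + (n + k))) * (n₀ + double n) C₂ (k₀ + double k)
    ≡⟨ cong₂ _*_ (C₂-lucas e₀b (%2-bit s) e′ (s / 2 + (n + k))) (C₂-lucas n₀b k₀b n k) ⟩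
  e₀ C₂ (s % 2) * X * (n₀ C₂ k₀ * n C₂ k)
    ≡⟨ interchange (e₀ C₂ (s % 2)) X (n₀ C₂ k₀) (n C₂ k) ⟩
  X * n C₂ k * (e₀ C₂ (s % 2) * n₀ C₂ k₀)
    ∎
  where
  s e′ X : ℕ
  s  = c + n₀ + k₀
  e′ = e + 2 ^ m * k₀ + 2 ^ suc m * k
  X  = e′ C₂ (s / 2 + (n + k))
  interchange : ∀ a x b y → a * x * (b * y) ≡ x * y * (a * b)
  interchange = solve-∀

T′-digit : ∀ m c {e₀ n₀} → Bit e₀ → Bit n₀ → ∀ e n →
  T′ (suc m) c (e₀ + double e) (n₀ + double n)
    ≡ T′ (suc m) ((c + n₀ + 0) / 2) e n * lowDigitFactor c e₀ n₀ 0
    + T′ (suc m) ((c + n₀ + 1) / 2) (e + 2 ^ m) n * lowDigitFactor c e₀ n₀ 1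
T′-digit m c {e₀} {n₀} e₀b n₀b e n = begin
  sumBelow f (suc (n₀ + double n))
    ≡⟨ sumBelow-extend (T′-summand-vanishes (suc m) c (e₀ + double e)) (range n₀b) ⟨
  sumBelow f (double (suc n))
    ≡⟨ sumBelow-double f (suc n) ⟩
  sumBelow (f ∘ double) (suc n) + sumBelow (f ∘ suc ∘ double) (suc n)
    ≡⟨ cong₂ _+_ (sumBelow-cong (suc n) (T′-summand-digit m c e₀b n₀b b0 e n))
                 (sumBelow-cong (suc n) (T′-summand-digit m c e₀b n₀b b1 e n)) ⟩
  sumBelow (λ k → f₀ k * w 0) (suc n) + sumBelow (λ k → f₁ k * w 1) (suc n)
    ≡⟨ cong₂ _+_ (sumBelow-*ʳ f₀ (w 0) (suc n)) (sumBelow-*ʳ f₁ (w 1) (suc n)) ⟩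
  T′ (suc m) c₀ (e + 2 ^ m * 0) n * w 0 + T′ (suc m) c₁ (e + 2 ^ m * 1) n * w 1
    ≡⟨ cong₂ (λ x y → T′ (suc m) c₀ x n * w 0 + T′ (suc m) c₁ y n * w 1)
             (e+P*0≡e e (2 ^ m)) (cong (e +_) (*-identityʳ (2 ^ m))) ⟩
  T′ (suc m) c₀ e n * w 0 + T′ (suc m) c₁ (e + 2 ^ m) n * w 1
    ∎
  where
  c₀ c₁ : ℕ
  c₀ = (c + n₀ + 0) / 2
  c₁ = (c + n₀ + 1) / 2
  f f₀ f₁ w : ℕ → ℕ
  f  = T′-summand (suc m) c (e₀ + double e) (n₀ + double n)
  f₀ = T′-summand (suc m) c₀ (e + 2 ^ m * 0) n
  f₁ = T′-summand (suc m) c₁ (e + 2 ^ m * 1) n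
  w  = lowDigitFactor c e₀ n₀
  range : ∀ {b} → Bit b → suc (b + double n) ≤ double (suc n)
  range b0 = n≤1+n _
  range b1 = ≤-refl

IsIndicator : ℕ → Set → Set
IsIndicator x P = (P → x ≡ 1) × (¬ P → x ≡ 0)

indicator-≡ : ∀ {x y P} → x ≡ y → IsIndicator y P → IsIndicator x P
indicator-≡ refl ind = ind

indicator-⇔ : ∀ {x P Q} → P ⇔ Q → IsIndicator x P → IsIndicator x Q
indicator-⇔ P⇔Q (yes , no) =
  yes ∘ Equivalence.from P⇔Q , λ ¬q → no (¬q ∘ Equivalence.to P⇔Q)

indicator-yes : ∀ {x P} → P → x ≡ 1 → IsIndicator x P
indicator-yes p x≡1 = (λ _ → x≡1) , (λ ¬p → ⊥-elim (¬p p))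

indicator-no : ∀ {x P} → ¬ P → x ≡ 0 → IsIndicator x P
indicator-no ¬p x≡0 = (λ p → ⊥-elim (¬p p)) , (λ _ → x≡0)

x*1+y*0≡x : ∀ x y → x * 1 + y * 0 ≡ x
x*1+y*0≡x = solve-∀

x*0+y*1≡y : ∀ x y → x * 0 + y * 1 ≡ y
x*0+y*1≡y = solve-∀

x*0+y*0≡0 : ∀ x y → x * 0 + y * 0 ≡ 0
x*0+y*0≡0 = solve-∀

x*1+y*1≡x+y : ∀ x y → x * 1 + y * 1 ≡ x + y
x*1+y*1≡x+y = solve-∀

-- The paper's m is suc m here.
module _ (m : ℕ) where

  out dead : ℕ → ℕ
  out  = T′ (suc m) 0 0
  dead = T′ (suc m) 1 0

  inRun : ℕ → ℕ → ℕ
  inRun j = T′ (suc m) 1 (2 ^ j)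

  -- Each transition is T′-digit with concrete digits, whose low-digit factors evaluate
  -- to 0 or 1.
  out-even : ∀ n → out (double n) ≡ out n
  out-even n = trans (T′-digit m 0 b0 b0 0 n) (x*1+y*0≡x (out n) (T′ (suc m) 0 (2 ^ m) n))

  out-odd : ∀ n → out (suc (double n)) ≡ inRun m n
  out-odd n = trans (T′-digit m 0 b0 b1 0 n) (x*0+y*1≡y (out n) (inRun m n))

  dead-even : ∀ n → dead (double n) ≡ 0
  dead-even n = trans (T′-digit m 1 b0 b0 0 n) (x*0+y*0≡0 (out n) (inRun m n))

  dead-odd : ∀ n → dead (suc (double n)) ≡ dead n
  dead-odd n = trans (T′-digit m 1 b0 b1 0 n) (x*1+y*0≡x (dead n) (inRun m n))

  inRun-zero-even : ∀ n → inRun 0 (double n) ≡ out n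
  inRun-zero-even n = trans (T′-digit m 1 b1 b0 0 n) (x*1+y*0≡x (out n) (inRun m n))

  inRun-zero-odd : ∀ n → inRun 0 (suc (double n)) ≡ dead n + inRun m n
  inRun-zero-odd n = trans (T′-digit m 1 b1 b1 0 n) (x*1+y*1≡x+y (dead n) (inRun m n))

  inRun-suc : ∀ j n → inRun (suc j) n ≡ T′ (suc m) 1 (double (2 ^ j)) n
  inRun-suc j n = cong (λ e → T′ (suc m) 1 e n) (sym (double≡2* (2 ^ j)))

  inRun-suc-even : ∀ j n → inRun (suc j) (double n) ≡ 0
  inRun-suc-even j n = trans (inRun-suc j (double n))
    (trans (T′-digit m 1 b0 b0 (2 ^ j) n)
           (x*0+y*0≡0 (T′ (suc m) 0 (2 ^ j) n) (T′ (suc m) 1 (2 ^ j + 2 ^ m) n)))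

  inRun-suc-odd : ∀ j n → inRun (suc j) (suc (double n)) ≡ inRun j n
  inRun-suc-odd j n = trans (inRun-suc j (suc (double n)))
    (trans (T′-digit m 1 b0 b1 (2 ^ j) n)
           (x*1+y*0≡x (inRun j n) (T′ (suc m) 1 (2 ^ j + 2 ^ m) n)))

  inRun-suc-zero : ∀ j → inRun (suc j) 0 ≡ 0
  inRun-suc-zero j = trans (inRun-suc j 0)
    (trans (T′-zero (suc m) 1 (double (2 ^ j))) (C₂-even-odd (2 ^ j) 0))

  dead≡0 : ∀ n → dead n ≡ 0
  dead≡0 = binary-ind (λ n → dead n ≡ 0) (T′-zero (suc m) 1 0)
    (λ n dead-n≡0 → trans (dead-odd n) dead-n≡0) (λ n _ → dead-even (suc n))

  RunsDivisible : ℕ → List Bool → Set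
  RunsDivisible r bs = All (suc m ∣_) (runsAux r bs)

  -- The first argument of runsAux is the length of the run read so far; inRun j is
  -- in charge of every such length suc r with suc r + j ≡ 0 (mod suc m).
  Invariant : ℕ → List Bool → Set
  Invariant n bs = IsIndicator (out n) (RunsDivisible 0 bs)
    × (∀ {j r} → j < suc m → suc m ∣ suc r + j →
         IsIndicator (inRun j n) (RunsDivisible (suc r) bs))

  run-unfinished : ∀ {j r} → suc j < suc m → suc m ∣ suc r + suc j → ¬ suc m ∣ suc r
  run-unfinished j<m m∣r+j m∣r = <⇒≱ j<m (∣⇒≤ (∣m+n∣m⇒∣n m∣r+j m∣r))

  run-finished : ∀ {r} → suc m ∣ suc r + 0 → suc m ∣ suc r
  run-finished = subst (suc m ∣_) (+-identityʳ _)

  invariant-zero : Invariant 0 []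
  invariant-zero = indicator-yes [] (T′-zero (suc m) 0 0) , inRun-correct
    where
    inRun-correct : ∀ {j r} → j < suc m → suc m ∣ suc r + j →
      IsIndicator (inRun j 0) (RunsDivisible (suc r) [])
    inRun-correct {zero}  _   m∣r =
      indicator-yes (run-finished m∣r ∷ []) (T′-zero (suc m) 1 1)
    inRun-correct {suc j} j<m m∣r+j =
      indicator-no (run-unfinished j<m m∣r+j ∘ head) (inRun-suc-zero j)

  invariant-odd : ∀ {n bs} → Invariant n bs → Invariant (suc (double n)) (true ∷ bs)
  invariant-odd {n} {bs} (_ , inRun-n) =
    indicator-≡ (out-odd n) (inRun-n ≤-refl ∣-refl) , inRun-correct
    where
    inRun-correct : ∀ {j r} → j < suc m → suc m ∣ suc r + j →
      IsIndicator (inRun j (suc (double n))) (RunsDivisible (suc r) (true ∷ bs))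
    inRun-correct {zero} {r} _ m∣r =
      indicator-≡ (trans (inRun-zero-odd n) (cong (_+ inRun m n) (dead≡0 n)))
        (inRun-n ≤-refl (subst (suc m ∣_) (sym (run-extended r m)) (∣m∣n⇒∣m+n m∣r ∣-refl)))
      where
      run-extended : ∀ r k → suc (suc r) + k ≡ suc r + 0 + suc k
      run-extended = solve-∀
    inRun-correct {suc j} {r} j<m m∣r+j =
      indicator-≡ (inRun-suc-odd j n)
        (inRun-n (≤-trans (n≤1+n _) j<m) (subst (suc m ∣_) (+-suc (suc r) j) m∣r+j))

  invariant-even : ∀ {n bs} → Invariant (suc n) bs → Invariant (double (suc n)) (false ∷ bs)
  invariant-even {n} {bs} (out-n , _) =
    indicator-≡ (out-even (suc n)) out-n , inRun-correct
    where
    inRun-correct : ∀ {j r} → j < suc m → suc m ∣ suc r + j →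
      IsIndicator (inRun j (double (suc n))) (RunsDivisible (suc r) (false ∷ bs))
    inRun-correct {zero}  _   m∣r =
      indicator-≡ (inRun-zero-even (suc n))
        (indicator-⇔ (mk⇔ (run-finished m∣r ∷_) tail) out-n)
    inRun-correct {suc j} j<m m∣r+j =
      indicator-no (run-unfinished j<m m∣r+j ∘ head) (inRun-suc-even j (suc n))

  invariant : ∀ n → Invariant n (binary n)
  invariant = binary-ind (λ n → Invariant n (binary n)) invariant-zero
    (λ n inv → subst (Invariant _) (sym (binary-odd n)) (invariant-odd {n} {binary n} inv))
    (λ n inv → subst (Invariant _) (sym (binary-even n))
                     (invariant-even {n} {binary (suc n)} inv))

-- The argument only needs m ≥ 1.
theorem16 : (m n : ℕ) → 2 ≤ m →
    (All (λ r → m ∣ r) (onesRuns n) → T m n ≡ 1) ×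
    (¬ All (λ r → m ∣ r) (onesRuns n) → T m n ≡ 0)
theorem16 zero    n ()
theorem16 (suc m) n _ = indicator-≡ (T≡T′ (suc m) n) (proj₁ (invariant m n))
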